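{- There is an absolute constant $c>0$ such that for all integers $k\ge 2$ and $n\ge 3k$, every deterministic streaming algorithm that computes $\mathsf{ApproxCount}_{k\text{ -counter}}\!\left[n,\frac{n}{3(k-1)}\right]$ uses at least $c\,k\log(n/k)$ bits of space.
   Context: For integers $k\ge2$, $n\ge1$ and real $\Delta\ge0$, $\mathsf{ApproxCount}_{k\text{ -counter}}[n,\Delta]$ is the following problem: on input $x=(x_1,\dots,x_n)\in[k]^n$, output a tuple of reals $(\hat S_1,\dots,\hat S_k)$ with $|\hat S_j-\#\{i\in[n]: x_i=j\}|\le\Delta$ for every $j\in[k]$; an algorithm computes the problem if its output is valid on every input (deterministic, worst case). A deterministic streaming algorithm using $s$ bits of space reads $x_1,\dots,x_n$ one symbol at a time; after each prefix it is in one of at most $2^s$ memory states, the next state is an arbitrary function of the time index, the current state and the next symbol, and the final output is an arbitrary function of the final state. (Equivalently, it is a read-once branching program of width at most $2^s$.)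
   Formalization: The outputs $\hat S_j$ of the streaming algorithms are rationals rather than reals. -}

module Defs where

open import Data.Nat using (ℕ; zero; suc; _+_; _*_; _^_)
open import Data.Fin using (Fin; _≟_)
open import Data.Vec using (Vec; []; _∷_)
open import Data.Integer using (+_)
open import Data.Rational using (ℚ; _/_; _-_; ∣_∣; _≤_; 0ℚ)
open import Relation.Nullary using (does)
open import Data.Bool using (if_then_else_)

-- A deterministic streaming algorithm over alphabet [k] = Fin k using s bits:
-- memory states are Fin (2 ^ s) (i.e. at most 2^s states), a fixed start state,
-- a transition depending on the time index, current state and next symbol,
-- and an output map from the final state to a k-tuple (j ↦ Ŝ_j).
record StreamAlg (k s : ℕ) : Set where
  field
    start : Fin (2 ^ s)
    step  : ℕ → Fin (2 ^ s) → Fin k → Fin (2 ^ s)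
    out   : Fin (2 ^ s) → Fin k → ℚ

open StreamAlg public

runFrom : ∀ {k s m} → StreamAlg k s → ℕ → Fin (2 ^ s) → Vec (Fin k) m → Fin (2 ^ s)
runFrom A t q []       = q
runFrom A t q (x ∷ xs) = runFrom A (suc t) (step A t q x) xs

finalState : ∀ {k s n} → StreamAlg k s → Vec (Fin k) n → Fin (2 ^ s)
finalState A x = runFrom A 0 (start A) x

count : ∀ {k n} → Fin k → Vec (Fin k) n → ℕ
count j []       = 0
count j (x ∷ xs) = (if does (x ≟ j) then 1 else 0) + count j xs

-- Δ = n / (3(k-1)); only meaningful for k ≥ 2 (value for k < 2 is irrelevant)
Δ : ℕ → ℕ → ℚ
Δ n (suc (suc m)) = (+ n) / (3 * suc m)
Δ n _             = 0ℚ

Computes : ∀ {k s} → StreamAlg k s → (n : ℕ) → ℚ → Set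
Computes {k} A n d = (x : Vec (Fin k) n) → (j : Fin k) →
  ∣ out A (finalState A x) j - ((+ count j x) / 1) ∣ ≤ d

{-# OPTIONS --safe #-}
-- Call a threshold vector p : Fin k → ℕ feasible at time t if some state q is
-- reached, for every letter j, by a length-t input with at most p j copies of j.
-- Every p is feasible at time 0. If p is feasible at t through q but not at t + 1,
-- then p j is the least count of j among the length-t inputs reaching q (otherwise
-- appending j would keep p feasible), so this exit point (t, q) determines p.
-- Correctness puts the counts of two inputs reaching the same state within 2Δ of
-- each other, which forces n ≤ 3 Σ p whenever p is feasible at time n. Hence the
-- b (b+1)^(k-1) vectors with p₀ < b and pᵢ ≤ b, for b = ⌊n/3k⌋, are infeasible at
-- n and have distinct exit points, so b (b+1)^(k-1) ≤ n 2^s; this rearranges to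
-- n^k ≤ 2^(60 s) k^k.

module Submission where

open import Defs
open import Data.Nat as ℕ using (ℕ; zero; suc; NonZero)
open import Data.Nat.Properties
open import Data.Nat.DivMod using (m≡m%n+[m/n]*n; m%n<n; m/n*n≤m; m≥n⇒m/n>0)
open import Data.Nat.Tactic.RingSolver using (solve-∀)
open import Data.Fin as Fin
  using (Fin; zero; suc; toℕ; fromℕ<; combine; quotient; remainder; finToFun; funToFin; punchIn)
open import Data.Fin.Properties
  using (toℕ<n; toℕ-injective; fromℕ<-injective; combine-injective; combine-remQuot;
         funToFin-finToFin; punchInᵢ≢i; any?; all?; injective⇒≤)
open import Data.Vec using (Vec; []; _∷_; _∷ʳ_; replicate)
open import Data.Product using (Σ; Σ-syntax; ∃; ∃-syntax; _×_; _,_)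
open import Data.Bool using (if_then_else_)
import Data.Integer as ℤ
import Data.Integer.Properties as ℤ
import Data.Integer.Tactic.RingSolver as ℤ-Solver
import Data.Rational as ℚ
import Data.Rational.Properties as ℚ
open import Data.Rational.Solver using (module +-*-Solver)
import Data.Rational.Unnormalised as ℚᵘ
import Data.Rational.Unnormalised.Properties as ℚᵘ
open import Algebra.Properties.Semiring.Sum +-*-semiring
  using (sum; sum-replicate-zero; ∑-distrib-+; *-distribʳ-sum)
open import Algebra.Properties.CommutativeSemigroup +-commutativeSemigroup using (x∙yz≈y∙xz)
open import Function using (_∘_)
open import Relation.Nullary using (Dec; yes; no; ¬_; does; contradiction)
open import Relation.Nullary.Decidable using (map′; _×-dec_; dec-true; dec-false)
open import Relation.Unary using (Decidable)
open import Relation.Binary.PropositionalEquality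

module _ where
  open import Data.Integer using (+_; -[1+_])
  open import Data.Rational using (mkℚ; _/_; _+_; _-_; _≤_; ∣_∣; *≤*; toℚᵘ)

  p≤∣p∣ : ∀ p → p ≤ ∣ p ∣
  p≤∣p∣ (mkℚ (+ _)     _ _) = ℚ.≤-refl
  p≤∣p∣ (mkℚ -[1+ _ ] _ _) = *≤* ℤ.-≤+

  ∣o-a∣≤r⇒∣o-b∣≤r⇒b≤a+[r+r] : ∀ o a b r → ∣ o - a ∣ ≤ r → ∣ o - b ∣ ≤ r → b ≤ a + (r + r)
  ∣o-a∣≤r⇒∣o-b∣≤r⇒b≤a+[r+r] o a b r ∣o-a∣≤r ∣o-b∣≤r = begin
    b                            ≡⟨ solve 3 (λ o a b → b := a :+ ((o :- a) :- (o :- b))) refl o a b ⟩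
    a + ((o - a) - (o - b))      ≤⟨ ℚ.+-monoʳ-≤ a (p≤∣p∣ _) ⟩
    a + ∣ (o - a) - (o - b) ∣    ≤⟨ ℚ.+-monoʳ-≤ a (ℚ.∣p-q∣≤∣p∣+∣q∣ (o - a) (o - b)) ⟩
    a + (∣ o - a ∣ + ∣ o - b ∣)  ≤⟨ ℚ.+-monoʳ-≤ a (ℚ.+-mono-≤ ∣o-a∣≤r ∣o-b∣≤r) ⟩
    a + (r + r)                  ∎
    where
    open ℚ.≤-Reasoning
    open +-*-Solver

  a/1≤b/1+[l/D+l/D]⇒aD≤bD+[l+l] : ∀ a b l D .{{_ : NonZero D}} →
    + a / 1 ≤ + b / 1 + (+ l / D + + l / D) → a ℕ.* D ℕ.≤ b ℕ.* D ℕ.+ (l ℕ.+ l)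
  a/1≤b/1+[l/D+l/D]⇒aD≤bD+[l+l] a b l D@(suc d) le =
    unpack (ℚᵘ.≤-respʳ-≃ rhs≃ (ℚᵘ.≤-respˡ-≃ (ℚ.toℚᵘ-fromℚᵘ _) (ℚ.toℚᵘ-mono-≤ le)))
    where
    l/Dᵘ = ℚᵘ.mkℚᵘ (+ l) d
    rhsᵘ = ℚᵘ.mkℚᵘ (+ b) 0 ℚᵘ.+ (l/Dᵘ ℚᵘ.+ l/Dᵘ)

    rhs≃ : toℚᵘ (+ b / 1 + (+ l / D + + l / D)) ℚᵘ.≃ rhsᵘ
    rhs≃ = ℚᵘ.≃-trans (ℚ.toℚᵘ-homo-+ (+ b / 1) (+ l / D + + l / D))
             (ℚᵘ.+-cong (ℚ.toℚᵘ-fromℚᵘ (ℚᵘ.mkℚᵘ (+ b) 0))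
               (ℚᵘ.≃-trans (ℚ.toℚᵘ-homo-+ (+ l / D) (+ l / D))
                 (ℚᵘ.+-cong (ℚ.toℚᵘ-fromℚᵘ l/Dᵘ) (ℚ.toℚᵘ-fromℚᵘ l/Dᵘ))))

    D²≡ : + (1 ℕ.* (D ℕ.* D)) ≡ + D ℤ.* + D
    D²≡ = trans (cong +_ (*-identityˡ (D ℕ.* D))) (ℤ.pos-* D D)

    regroup : ∀ x y z → (x ℤ.* (z ℤ.* z) ℤ.+ (y ℤ.* z ℤ.+ y ℤ.* z) ℤ.* + 1) ℤ.* + 1
                      ≡ (x ℤ.* z ℤ.+ (y ℤ.+ y)) ℤ.* z
    regroup = ℤ-Solver.solve-∀

    unpack : ℚᵘ.mkℚᵘ (+ a) 0 ℚᵘ.≤ rhsᵘ → a ℕ.* D ℕ.≤ b ℕ.* D ℕ.+ (l ℕ.+ l)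
    unpack (ℚᵘ.*≤* le) = ℤ.drop‿+≤+ (ℤ.*-cancelʳ-≤-pos _ _ (+ D) (begin
      + (a ℕ.* D) ℤ.* + D              ≡⟨ cong (ℤ._* + D) (ℤ.pos-* a D) ⟩
      + a ℤ.* + D ℤ.* + D               ≡⟨ ℤ.*-assoc (+ a) (+ D) (+ D) ⟩
      + a ℤ.* (+ D ℤ.* + D)             ≡⟨ cong (+ a ℤ.*_) D²≡ ⟨
      + a ℤ.* ℚᵘ.↧ rhsᵘ                 ≤⟨ le ⟩
      ℚᵘ.↥ rhsᵘ ℤ.* + 1
        ≡⟨ cong (λ e → (+ b ℤ.* e ℤ.+ ℚᵘ.↥ (l/Dᵘ ℚᵘ.+ l/Dᵘ) ℤ.* + 1) ℤ.* + 1) (ℤ.pos-* D D) ⟩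
      _                                 ≡⟨ regroup (+ b) (+ l) (+ D) ⟩
      (+ b ℤ.* + D ℤ.+ (+ l ℤ.+ + l)) ℤ.* + D
        ≡⟨ cong (λ e → (e ℤ.+ (+ l ℤ.+ + l)) ℤ.* + D) (ℤ.pos-* b D) ⟨
      + (b ℕ.* D ℕ.+ (l ℕ.+ l)) ℤ.* + D ∎))
      where open ℤ.≤-Reasoning

  Within : ℚ.ℚ → ℚ.ℚ → ℕ → Set
  Within d o c = ∣ o - + c / 1 ∣ ≤ d

  within-same⇒close : ∀ o a b l D .{{_ : NonZero D}} →
    Within (+ l / D) o a → Within (+ l / D) o b → b ℕ.* D ℕ.≤ a ℕ.* D ℕ.+ (l ℕ.+ l)
  within-same⇒close o a b l D o≈a o≈b =
    a/1≤b/1+[l/D+l/D]⇒aD≤bD+[l+l] b a l D (∣o-a∣≤r⇒∣o-b∣≤r⇒b≤a+[r+r] o _ _ _ o≈a o≈b)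

open import Data.Nat using (_+_; _*_; _^_; _≤_; _<_; z≤n; s≤s)

sum-mono-≤ : ∀ {n} {f g : Fin n → ℕ} → (∀ i → f i ≤ g i) → sum f ≤ sum g
sum-mono-≤ {zero}  f≤g = z≤n
sum-mono-≤ {suc n} f≤g = +-mono-≤ (f≤g zero) (sum-mono-≤ (f≤g ∘ suc))

sum-const : ∀ n c → sum {n} (λ _ → c) ≡ n * c
sum-const zero    c = refl
sum-const (suc n) c = cong (c +_) (sum-const n c)

sum-≤-with-slack : ∀ {n c} {f g : Fin (suc n) → ℕ} →
                   f zero ≤ g zero → (∀ i → f (suc i) ≤ g (suc i) + c) → sum f ≤ sum g + n * c
sum-≤-with-slack {n} {c} {f} {g} f₀≤g₀ f≤g+c = begin
  f zero + sum (f ∘ suc)                        ≤⟨ +-mono-≤ f₀≤g₀ (sum-mono-≤ f≤g+c) ⟩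
  g zero + sum (λ i → g (suc i) + c)            ≡⟨ cong (g zero +_) (∑-distrib-+ (g ∘ suc) (λ _ → c)) ⟩
  g zero + (sum (g ∘ suc) + sum {n} (λ _ → c))  ≡⟨ cong (λ x → g zero + (sum (g ∘ suc) + x)) (sum-const n c) ⟩
  g zero + (sum (g ∘ suc) + n * c)              ≡⟨ +-assoc (g zero) _ _ ⟨
  g zero + sum (g ∘ suc) + n * c                ∎
  where open ≤-Reasoning

δ : ∀ {k} → Fin k → Fin k → ℕ
δ i j = if does (i Fin.≟ j) then 1 else 0

sum-δ : ∀ {k} (i : Fin k) → sum (δ i) ≡ 1
sum-δ {suc k} zero    = cong suc (sum-replicate-zero k)
sum-δ         (suc i) = sum-δ i

module _ {k : ℕ} where

  sum-count : ∀ {t} (xs : Vec (Fin k) t) → sum (λ j → count j xs) ≡ t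
  sum-count []       = sum-replicate-zero k
  sum-count (x ∷ xs) = trans (∑-distrib-+ (δ x) (λ j → count j xs)) (cong₂ _+_ (sum-δ x) (sum-count xs))

  count-∷ʳ : ∀ {t} (j i : Fin k) (xs : Vec (Fin k) t) → count j (xs ∷ʳ i) ≡ count j (i ∷ xs)
  count-∷ʳ j i []       = refl
  count-∷ʳ j i (x ∷ xs) = trans (cong (δ x j +_) (count-∷ʳ j i xs)) (x∙yz≈y∙xz (δ x j) (δ i j) (count j xs))

  count-∷ʳ-≡ : ∀ {t} (j : Fin k) (xs : Vec (Fin k) t) → count j (xs ∷ʳ j) ≡ suc (count j xs)
  count-∷ʳ-≡ j xs = trans (count-∷ʳ j j xs)
    (cong (λ b → (if b then 1 else 0) + count j xs) (dec-true (j Fin.≟ j) refl))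

  count-∷ʳ-≢ : ∀ {t} {j i : Fin k} (xs : Vec (Fin k) t) → i ≢ j → count j (xs ∷ʳ i) ≡ count j xs
  count-∷ʳ-≢ {j = j} {i} xs i≢j = trans (count-∷ʳ j i xs)
    (cong (λ b → (if b then 1 else 0) + count j xs) (dec-false (i Fin.≟ j) i≢j))

  count-replicate-≢ : ∀ {j i : Fin k} t → i ≢ j → count j (replicate t i) ≡ 0
  count-replicate-≢         zero    i≢j = refl
  count-replicate-≢ {j} {i} (suc t) i≢j =
    cong₂ (λ b c → (if b then 1 else 0) + c) (dec-false (i Fin.≟ j) i≢j) (count-replicate-≢ t i≢j)

∃-crossing : ∀ {p} {P : ℕ → Set p} → Decidable P → P 0 → ∀ {n} → ¬ P n → ∃[ t ] t < n × P t × ¬ P (suc t)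
∃-crossing P? P0 {zero}  ¬P0 = contradiction P0 ¬P0
∃-crossing P? P0 {suc n} ¬P1+n with P? n
... | yes Pn  = n , n<1+n n , Pn , ¬P1+n
... | no  ¬Pn = let t , t<n , Pt , ¬P1+t = ∃-crossing P? P0 ¬Pn in t , m<n⇒m<1+n t<n , Pt , ¬P1+t

m<[1+m/n]*n : ∀ m n .{{_ : NonZero n}} → m < suc (m ℕ./ n) * n
m<[1+m/n]*n m n = begin-strict
  m                            ≡⟨ m≡m%n+[m/n]*n m n ⟩
  m ℕ.% n + m ℕ./ n * n        <⟨ +-monoˡ-< (m ℕ./ n * n) (m%n<n m n) ⟩
  n + m ℕ./ n * n              ∎
  where open ≤-Reasoning

^-distribʳ-* : ∀ m n o → (m * n) ^ o ≡ m ^ o * n ^ o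
^-distribʳ-* m n zero    = refl
^-distribʳ-* m n (suc o) = trans (cong (m * n *_) (^-distribʳ-* m n o)) (interchange m n (m ^ o) (n ^ o))
  where
  interchange : ∀ a b c d → a * b * (c * d) ≡ a * c * (b * d)
  interchange = solve-∀

n*n≤2*2^n : ∀ n → n * n ≤ 2 * 2 ^ n
n*n≤2*2^n 0 = z≤n
n*n≤2*2^n 1 = ≤ᵇ⇒≤ 1 4 _
n*n≤2*2^n 2 = ≤ᵇ⇒≤ 4 8 _
n*n≤2*2^n 3 = ≤ᵇ⇒≤ 9 16 _
n*n≤2*2^n (suc n@(suc (suc (suc m)))) = begin
  suc n * suc n                       ≤⟨ m≤m+n (suc n * suc n) (m * m + 4 * m + 2) ⟩
  suc n * suc n + (m * m + 4 * m + 2) ≡⟨ square-step m ⟩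
  2 * (n * n)                         ≤⟨ *-monoʳ-≤ 2 (n*n≤2*2^n n) ⟩
  2 * (2 * 2 ^ n)                     ∎
  where
  open ≤-Reasoning
  square-step : ∀ m → (4 + m) * (4 + m) + (m * m + 4 * m + 2) ≡ 2 * ((3 + m) * (3 + m))
  square-step = solve-∀

module _ {M b n X : ℕ} (1≤M : 1 ≤ M) (1≤b : 1 ≤ b) (2≤X : 2 ≤ X)
         (b*c^M≤n*X : b * suc b ^ M ≤ n * X) (n≤c*3K : n ≤ suc b * (3 * suc M)) where

  private
    c K : ℕ
    c = suc b
    K = suc M

    2≤c : 2 ≤ c
    2≤c = s≤s 1≤b

  c^M≤6KX : c ^ M ≤ 6 * K * X
  c^M≤6KX = *-cancelˡ-≤ c (begin
    c * c ^ M              ≤⟨ *-monoˡ-≤ (c ^ M) (+-monoˡ-≤ b 1≤b) ⟩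
    (b + b) * c ^ M        ≡⟨ e₁ b (c ^ M) ⟩
    2 * (b * c ^ M)        ≤⟨ *-monoʳ-≤ 2 b*c^M≤n*X ⟩
    2 * (n * X)            ≤⟨ *-monoʳ-≤ 2 (*-monoˡ-≤ X n≤c*3K) ⟩
    2 * (c * (3 * K) * X)  ≡⟨ e₂ c K X ⟩
    c * (6 * K * X)        ∎)
    where
    open ≤-Reasoning
    e₁ : ∀ b y → (b + b) * y ≡ 2 * (b * y)
    e₁ = solve-∀
    e₂ : ∀ c K X → 2 * (c * (3 * K) * X) ≡ c * (6 * K * X)
    e₂ = solve-∀

  K≤24X : K ≤ 24 * X
  K≤24X = *-cancelˡ-≤ K (begin
    K * K            ≤⟨ n*n≤2*2^n K ⟩
    2 * (2 * 2 ^ M)  ≡⟨ *-assoc 2 2 (2 ^ M) ⟨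
    4 * 2 ^ M        ≤⟨ *-monoʳ-≤ 4 (^-monoˡ-≤ M 2≤c) ⟩
    4 * c ^ M        ≤⟨ *-monoʳ-≤ 4 c^M≤6KX ⟩
    4 * (6 * K * X)  ≡⟨ e K X ⟩
    K * (24 * X)     ∎)
    where
    open ≤-Reasoning
    e : ∀ K X → 4 * (6 * K * X) ≡ K * (24 * X)
    e = solve-∀

  c^M≤X^10 : c ^ M ≤ X ^ 10
  c^M≤X^10 = begin
    c ^ M               ≤⟨ c^M≤6KX ⟩
    6 * K * X           ≤⟨ *-monoˡ-≤ X (*-monoʳ-≤ 6 K≤24X) ⟩
    6 * (24 * X) * X    ≡⟨ e X ⟩
    144 * X ^ 2         ≤⟨ *-monoˡ-≤ (X ^ 2) (≤-trans (≤ᵇ⇒≤ 144 256 _) (^-monoˡ-≤ 8 2≤X)) ⟩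
    X ^ 8 * X ^ 2       ≡⟨ ^-distribˡ-+-* X 8 2 ⟨
    X ^ 10              ∎
    where
    open ≤-Reasoning
    e : ∀ X → 6 * (24 * X) * X ≡ 144 * (X * (X * 1))
    e = solve-∀

  n≤Kc³ : n ≤ K * c ^ 3
  n≤Kc³ = begin
    n                ≤⟨ n≤c*3K ⟩
    c * (3 * K)      ≤⟨ *-monoʳ-≤ c (*-monoˡ-≤ K (≤-trans (≤ᵇ⇒≤ 3 4 _) (*-mono-≤ 2≤c 2≤c))) ⟩
    c * (c * c * K)  ≡⟨ e c K ⟩
    K * c ^ 3        ∎
    where
    open ≤-Reasoning
    e : ∀ c K → c * (c * c * K) ≡ K * (c * (c * (c * 1)))
    e = solve-∀

  [c³]^K≤X^60 : (c ^ 3) ^ K ≤ X ^ 60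
  [c³]^K≤X^60 = begin
    (c ^ 3) ^ K      ≡⟨ ^-*-assoc c 3 K ⟩
    c ^ (3 * K)      ≤⟨ ^-monoʳ-≤ c 3K≤6M ⟩
    c ^ (M * 6)      ≡⟨ ^-*-assoc c M 6 ⟨
    (c ^ M) ^ 6      ≤⟨ ^-monoˡ-≤ 6 c^M≤X^10 ⟩
    (X ^ 10) ^ 6     ≡⟨ ^-*-assoc X 10 6 ⟩
    X ^ 60           ∎
    where
    open ≤-Reasoning
    e : ∀ M → 3 * (M + M) ≡ M * 6
    e = solve-∀
    3K≤6M : 3 * K ≤ M * 6
    3K≤6M = ≤-trans (*-monoʳ-≤ 3 (+-monoˡ-≤ M 1≤M)) (≤-reflexive (e M))

  n^K≤X^60*K^K : n ^ K ≤ X ^ 60 * K ^ K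
  n^K≤X^60*K^K = begin
    n ^ K                ≤⟨ ^-monoˡ-≤ K n≤Kc³ ⟩
    (K * c ^ 3) ^ K      ≡⟨ ^-distribʳ-* K (c ^ 3) K ⟩
    K ^ K * (c ^ 3) ^ K  ≤⟨ *-monoʳ-≤ (K ^ K) [c³]^K≤X^60 ⟩
    K ^ K * X ^ 60       ≡⟨ *-comm (K ^ K) (X ^ 60) ⟩
    X ^ 60 * K ^ K       ∎
    where open ≤-Reasoning

funToFin-cong : ∀ {m n} {f g : Fin m → Fin n} → (∀ i → f i ≡ g i) → funToFin f ≡ funToFin g
funToFin-cong {zero}  _   = refl
funToFin-cong {suc m} f≗g = cong₂ combine (f≗g zero) (funToFin-cong (f≗g ∘ suc))

finToFun-injective : ∀ {m n} {a a′ : Fin (m ^ n)} → (∀ i → finToFun {m} {n} a i ≡ finToFun a′ i) → a ≡ a′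
finToFun-injective {m} {n} {a} {a′} eq =
  trans (sym (funToFin-finToFin {n} {m} a)) (trans (funToFin-cong eq) (funToFin-finToFin {n} {m} a′))

module _ (b M : ℕ) where

  leading : Fin (b * suc b ^ M) → Fin b
  leading = quotient (suc b ^ M)

  trailing : Fin (b * suc b ^ M) → Fin (suc b ^ M)
  trailing = remainder {b} (suc b ^ M)

  digits : Fin (b * suc b ^ M) → Fin (suc M) → ℕ
  digits a zero    = toℕ (leading a)
  digits a (suc i) = toℕ (finToFun {suc b} {M} (trailing a) i)

  digits-injective : ∀ {a a′} → (∀ j → digits a j ≡ digits a′ j) → a ≡ a′
  digits-injective {a} {a′} eq = begin
    a                                ≡⟨ combine-remQuot {b} (suc b ^ M) a ⟨
    combine (leading a) (trailing a)   ≡⟨ cong₂ combine (toℕ-injective (eq zero))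
                                           (finToFun-injective (toℕ-injective ∘ eq ∘ suc)) ⟩
    combine (leading a′) (trailing a′) ≡⟨ combine-remQuot {b} (suc b ^ M) a′ ⟩
    a′                               ∎
    where open ≡-Reasoning

  sum-digits< : ∀ a → sum (digits a) < suc M * b
  sum-digits< a = +-mono-≤ (toℕ<n (leading a)) (begin
    sum (digits a ∘ suc)  ≤⟨ sum-mono-≤ {g = λ _ → b} (≤-pred ∘ toℕ<n ∘ finToFun {suc b} {M} (trailing a)) ⟩
    sum {M} (λ _ → b)     ≡⟨ sum-const M b ⟩
    M * b                 ∎)
    where open ≤-Reasoning

any?-Vec : ∀ {k p} t {P : Vec (Fin k) t → Set p} → Decidable P → Dec (∃ P)
any?-Vec zero    P? = map′ ([] ,_) (λ { ([] , P[]) → P[] }) (P? [])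
any?-Vec (suc t) P? = map′ (λ (i , xs , Pixs) → i ∷ xs , Pixs) (λ { (i ∷ xs , Pixs) → i , xs , Pixs })
                           (any? λ i → any?-Vec t (P? ∘ (i ∷_)))

runFrom-∷ʳ : ∀ {k s m} (A : StreamAlg k s) t q (xs : Vec (Fin k) m) j →
             runFrom A t q (xs ∷ʳ j) ≡ step A (t + m) (runFrom A t q xs) j
runFrom-∷ʳ A t q []       j = cong (λ u → step A u q j) (sym (+-identityʳ t))
runFrom-∷ʳ {m = suc m} A t q (x ∷ xs) j =
  trans (runFrom-∷ʳ A (suc t) (step A t q x) xs j)
        (cong (λ u → step A u (runFrom A (suc t) (step A t q x) xs) j) (sym (+-suc t m)))

finalState-∷ʳ : ∀ {k s m} (A : StreamAlg k s) (xs : Vec (Fin k) m) j →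
                finalState A (xs ∷ʳ j) ≡ step A m (finalState A xs) j
finalState-∷ʳ A = runFrom-∷ʳ A 0 (start A)

module _ {k s : ℕ} (A : StreamAlg k s) where

  Below : ℕ → (Fin k → ℕ) → Fin (2 ^ s) → Set
  Below t p q = ∀ j → Σ[ x ∈ Vec (Fin k) t ] finalState A x ≡ q × count j x ≤ p j

  Feasible : ℕ → (Fin k → ℕ) → Set
  Feasible t p = ∃ (Below t p)

  feasible? : ∀ t p → Dec (Feasible t p)
  feasible? t p = any? λ q → all? λ j → any?-Vec t λ x → (finalState A x Fin.≟ q) ×-dec (count j x ≤? p j)

  feasible-0 : ∀ p → Feasible 0 p
  feasible-0 p = start A , λ j → [] , refl , z≤n

  stuck⇒≤count : ∀ {t p q} → Below t p q → ¬ Feasible (suc t) p →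
                 ∀ j (x : Vec (Fin k) t) → finalState A x ≡ q → p j ≤ count j x
  stuck⇒≤count {t} {p} {q} below stuck j x x↦q = ≮⇒≥ λ count<p → stuck (step A t q j , extend count<p)
    where
    append : ∀ y → finalState A y ≡ q → finalState A (y ∷ʳ j) ≡ step A t q j
    append y y↦q = trans (finalState-∷ʳ A y j) (cong (λ r → step A t r j) y↦q)
    extend : count j x < p j → Below (suc t) p (step A t q j)
    extend count<p i with j Fin.≟ i
    ... | yes refl = x ∷ʳ j , append x x↦q , subst (_≤ p j) (sym (count-∷ʳ-≡ j x)) count<p
    ... | no j≢i   = let y , y↦q , y≤p = below i in
                     y ∷ʳ j , append y y↦q , subst (_≤ p i) (sym (count-∷ʳ-≢ y j≢i)) y≤p

  stuck-below⇒≤ : ∀ {t p p′ q} → Below t p q → ¬ Feasible (suc t) p → Below t p′ q → ∀ j → p j ≤ p′ j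
  stuck-below⇒≤ below stuck below′ j =
    let x , x↦q , x≤p′ = below′ j in ≤-trans (stuck⇒≤count below stuck j x x↦q) x≤p′

  Exit : ℕ → (Fin k → ℕ) → Set
  Exit n p = ∃[ t ] t < n × Feasible t p × ¬ Feasible (suc t) p

  exit : ∀ {n p} → ¬ Feasible n p → Exit n p
  exit {p = p} = ∃-crossing (λ t → feasible? t p) (feasible-0 p)

  exitCode : ∀ {n p} → Exit n p → Fin (n * 2 ^ s)
  exitCode (t , t<n , (q , _) , _) = combine (fromℕ< t<n) q

  exitCode-injective : ∀ {n p p′} (e : Exit n p) (e′ : Exit n p′) →
                       exitCode e ≡ exitCode e′ → ∀ j → p j ≡ p′ j
  exitCode-injective (t , t<n , (q , below) , stuck) (t′ , t′<n , (q′ , below′) , stuck′) eq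
    with combine-injective (fromℕ< t<n) q (fromℕ< t′<n) q′ eq
  ... | t≡t′ , refl with fromℕ<-injective t t′ t<n t′<n t≡t′
  ... | refl = λ j → ≤-antisym (stuck-below⇒≤ below stuck below′ j) (stuck-below⇒≤ below′ stuck′ below j)

  infeasible-family-bound : ∀ {N n} (p : Fin N → Fin k → ℕ) →
                            (∀ {a a′} → (∀ j → p a j ≡ p a′ j) → a ≡ a′) →
                            (∀ a → ¬ Feasible n (p a)) → N ≤ n * 2 ^ s
  infeasible-family-bound p p-injective infeasible = injective⇒≤ {f = code} λ {a} {a′} eq →
    p-injective (exitCode-injective (exit (infeasible a)) (exit (infeasible a′)) eq)
    where
    code = λ a → exitCode (exit (infeasible a))

module _ {m s n : ℕ} (A : StreamAlg (suc (suc m)) s) (computes : Computes A n (Δ n (suc (suc m)))) where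

  same-state⇒count≤ : ∀ {q} (x y : Vec (Fin (suc (suc m))) n) → finalState A x ≡ q → finalState A y ≡ q →
                      ∀ j → count j y * (3 * suc m) ≤ count j x * (3 * suc m) + (n + n)
  same-state⇒count≤ x y refl y↦x j =
    within-same⇒close (out A (finalState A x) j) (count j x) (count j y) n (3 * suc m) (computes x j)
      (subst (λ q → Within (Δ n (suc (suc m))) (out A q j) (count j y)) y↦x (computes y j))

  feasible⇒n≤3*sum : ∀ {p} → Feasible A n p → n ≤ 3 * sum p
  feasible⇒n≤3*sum {p} (q , below) with below zero
  ... | y , y↦q , count₀≤p₀ = +-cancelʳ-≤ (n + n) n (3 * sum p) (*-cancelˡ-≤ (suc m) (begin
    suc m * (n + (n + n))                         ≡⟨ e₁ (suc m) n ⟩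
    n * D                                         ≡⟨ cong (_* D) (sum-count y) ⟨
    sum (λ j → count j y) * D                     ≡⟨ *-distribʳ-sum D (λ j → count j y) ⟩
    sum (λ j → count j y * D)
      ≤⟨ sum-≤-with-slack {f = λ j → count j y * D} {g = λ j → p j * D} (*-monoˡ-≤ D count₀≤p₀) (count≤ ∘ suc) ⟩
    sum (λ j → p j * D) + suc m * (n + n)         ≡⟨ cong (_+ suc m * (n + n)) (*-distribʳ-sum D p) ⟨
    sum p * D + suc m * (n + n)                   ≡⟨ e₂ (suc m) n (sum p) ⟩
    suc m * (3 * sum p + (n + n))                 ∎))
    where
    open ≤-Reasoning
    D = 3 * suc m
    count≤ : ∀ j → count j y * D ≤ p j * D + (n + n)
    count≤ j = let x , x↦q , x≤p = below j in
      ≤-trans (same-state⇒count≤ x y x↦q y↦q j) (+-monoˡ-≤ (n + n) (*-monoˡ-≤ D x≤p))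
    e₁ : ∀ K n → K * (n + (n + n)) ≡ n * (3 * K)
    e₁ = solve-∀
    e₂ : ∀ K n S → S * (3 * K) + K * (n + n) ≡ K * (3 * S + (n + n))
    e₂ = solve-∀

  infeasible : ∀ {p} → 3 * sum p < n → ¬ Feasible A n p
  infeasible 3Σp<n feasible = <⇒≱ 3Σp<n (feasible⇒n≤3*sum feasible)

one-state-feasible : ∀ {m t} (A : StreamAlg (suc (suc m)) 0) p → Feasible A t p
one-state-feasible {t = t} A p = zero , λ j →
  replicate t (punchIn j zero) , only-state _ ,
  subst (_≤ p j) (sym (count-replicate-≢ t (punchInᵢ≢i j zero))) z≤n
  where
  only-state : (q : Fin 1) → q ≡ zero
  only-state zero = refl

computes⇒1≤s : ∀ {m s n} (A : StreamAlg (suc (suc m)) s) →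
               Computes A n (Δ n (suc (suc m))) → 1 ≤ n → 1 ≤ s
computes⇒1≤s {m} {zero} {n} A computes 1≤n =
  contradiction (one-state-feasible A (λ _ → 0)) (infeasible A computes (subst (_< n) (sym 3*0≡0) 1≤n))
  where
  3*0≡0 : 3 * sum {suc (suc m)} (λ _ → 0) ≡ 0
  3*0≡0 = cong (3 *_) (sum-replicate-zero (suc (suc m)))
computes⇒1≤s {s = suc _} _ _ _ = s≤s z≤n

space-lower-bound : ∀ {m s n} (A : StreamAlg (suc (suc m)) s) → 3 * suc (suc m) ≤ n →
                    Computes A n (Δ n (suc (suc m))) →
                    n ^ suc (suc m) ≤ 2 ^ (60 * s) * suc (suc m) ^ suc (suc m)
space-lower-bound {m} {s} {n} A 3k≤n computes =
  subst (λ X → n ^ k ≤ X * k ^ k) [2^s]^60≡2^[60s] (n^K≤X^60*K^K (s≤s z≤n) 1≤b 2≤2^s pigeonhole n≤[1+b]*3k)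
  where
  k = suc (suc m)
  b = n ℕ./ (3 * k)

  1≤b : 1 ≤ b
  1≤b = m≥n⇒m/n>0 3k≤n

  n≤[1+b]*3k : n ≤ suc b * (3 * k)
  n≤[1+b]*3k = <⇒≤ (m<[1+m/n]*n n (3 * k))

  2≤2^s : 2 ≤ 2 ^ s
  2≤2^s = ^-monoʳ-≤ 2 (computes⇒1≤s A computes (≤-trans (s≤s z≤n) 3k≤n))

  3*sum<n : ∀ a → 3 * sum (digits b (suc m) a) < n
  3*sum<n a = begin-strict
    3 * sum (digits b (suc m) a)  <⟨ *-monoʳ-< 3 (sum-digits< b (suc m) a) ⟩
    3 * (k * b)         ≡⟨ *-assoc 3 k b ⟨
    3 * k * b           ≡⟨ *-comm (3 * k) b ⟩
    b * (3 * k)         ≤⟨ m/n*n≤m n (3 * k) ⟩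
    n                   ∎
    where open ≤-Reasoning

  pigeonhole : b * suc b ^ suc m ≤ n * 2 ^ s
  pigeonhole = infeasible-family-bound A (digits b (suc m)) (digits-injective b (suc m))
                                         (infeasible A computes ∘ 3*sum<n)

  [2^s]^60≡2^[60s] : (2 ^ s) ^ 60 ≡ 2 ^ (60 * s)
  [2^s]^60≡2^[60s] = trans (^-*-assoc 2 s 60) (cong (2 ^_) (*-comm s 60))

theorem1p1 : Σ ℕ λ p → Σ ℕ λ q → NonZero p × NonZero q ×
    ((k n s : ℕ) → 2 ≤ k → 3 * k ≤ n → (A : StreamAlg k s) →
      Computes A n (Δ n k) →
      n ^ (p * k) ≤ 2 ^ (q * s) * k ^ (p * k))
theorem1p1 = 1 , 60 , _ , _ , bound
  where
  bound : (k n s : ℕ) → 2 ≤ k → 3 * k ≤ n → (A : StreamAlg k s) → Computes A n (Δ n k) →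
          n ^ (1 * k) ≤ 2 ^ (60 * s) * k ^ (1 * k)
  bound k n s (s≤s (s≤s _)) 3k≤n A computes =
    subst (λ e → n ^ e ≤ 2 ^ (60 * s) * k ^ e) (sym (*-identityˡ k)) (space-lower-bound A 3k≤n computes)
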